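{- If vertices $u,v\in V$ are actively connected, then $\tau_u=\tau_v$.
   Context: Steiner Forest: an undirected graph $G=(V,E)$ with nonnegative edge costs $c_e$ and a set of demand pairs $\{a,b\}\subseteq V$; vertices of a demand pair are partners. For $U\subseteq V$, $\delta(U)$ is the set of edges with exactly one endpoint in $U$. $\varepsilon$-extended moat-growing algorithm (fixed $\varepsilon\ge0$): time $t$ increases from $0$; it maintains $y_S(t)\ge0$ for all $S\subseteq V$, initially $0$; an edge $e$ is tight if $\sum_{S:e\in\delta(S)}y_S(t)=c_e$; $F$ is the set of tight edges and $\mathcal C^t$ the vertex sets of components of $(V,F)$. Each component has a budget (each vertex initially $0$). A component is demand-active if it contains a vertex not yet connected in $(V,F)$ to one of its partners, budget-active if not demand-active but with positive budget, active if either; $\mathcal A^t$ is the set of active components. Each $y_S$, $S\in\mathcal A^t$, grows at unit rate; budgets of demand-active components grow at rate $\varepsilon$, those of budget-active components decrease at unit rate; newly tight edges are added to $F$ and merged components' budgets are summed. The deactivation time $\tau_v$ of $v\in V$ is the largest $t$ such that for all $s<t$, $v$ belongs to some set of $\mathcal A^s$. Vertices $u,v$ are actively connected if there is a time $t$ such that $u$ and $v$ lie in the same set of $\mathcal C^t$ and $\tau_u\ge t$ and $\tau_v\ge t$.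
   Formalization: The edge costs $c_e$ and the parameter ε are rational, and all times, including the deactivation times $\tau_v$ (which may also be infinite), range over ℚ. -}

module Defs where

open import Data.Nat using (ℕ; zero; suc)
open import Data.Bool using (Bool; true; false; _∧_; _∨_; not; _xor_; if_then_else_)
import Data.Bool.Properties as BoolP
open import Data.Fin using (Fin; toℕ)
import Data.Fin.Properties as FinP
open import Data.Fin.Subset using (Subset; ⁅_⁆)
open import Data.Vec using (Vec; []; _∷_; lookup; tabulate)
open import Data.Vec.Properties using (≡-dec)
open import Data.List using (List; []; _∷_; _++_; map; filter; foldr; concatMap; allFin)
open import Data.Bool.ListAction using (any; all)
open import Data.Maybe using (Maybe; just; nothing; fromMaybe)
open import Data.Product using (_×_; _,_; Σ; proj₁)
open import Data.Sum using (_⊎_)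
open import Data.Unit using (⊤)
open import Data.Rational using (ℚ; 0ℚ; 1ℚ; ½; _+_; _-_; _*_; -_; _⊓_; _≤_; _<_)
import Data.Rational.Properties as ℚP
open import Relation.Nullary.Decidable using (⌊_⌋)
open import Relation.Binary.PropositionalEquality using (_≡_)

iter : {A : Set} → ℕ → (A → A) → A → A
iter zero    f a = a
iter (suc k) f a = f (iter k f a)

sumℚ : List ℚ → ℚ
sumℚ = foldr _+_ 0ℚ

minList : List ℚ → Maybe ℚ
minList []       = nothing
minList (q ∷ qs) with minList qs
... | nothing = just q
... | just m  = just (q ⊓ m)

allSubsets : (n : ℕ) → List (Subset n)
allSubsets zero    = [] ∷ []
allSubsets (suc n) = map (true ∷_) (allSubsets n) ++ map (false ∷_) (allSubsets n)

data ℚ∞ : Set where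
  fin : ℚ → ℚ∞
  ∞   : ℚ∞

_≤∞_ : ℚ → ℚ∞ → Set
t ≤∞ fin q = t ≤ q
t ≤∞ ∞     = ⊤

_<∞_ : ℚ → ℚ∞ → Set
t <∞ fin q = t < q
t <∞ ∞     = ⊤

-- The ε-extended moat-growing algorithm on a Steiner Forest instance.

Edge : ℕ → Set
Edge n = Fin n × Fin n × ℚ

module MoatGrowing (n : ℕ) (E : List (Edge n)) (D : List (Fin n × Fin n)) (ε : ℚ) where

  mem : Subset n → Fin n → Bool
  mem S x = lookup S x

  _==_ : Fin n → Fin n → Bool
  x == y = ⌊ x FinP.≟ y ⌋

  _=S_ : Subset n → Subset n → Bool
  S =S T = ⌊ ≡-dec BoolP._≟_ S T ⌋

  cut : Edge n → Subset n → Bool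
  cut (a , b , _) S = mem S a xor mem S b

  cost : Edge n → ℚ
  cost (_ , _ , c) = c

  record State : Set where
    field
      time : ℚ
      y    : Subset n → ℚ       -- the dual variables y_S for all S ⊆ V
      bud  : Fin n → ℚ
  open State public

  load : State → Edge n → ℚ
  load st e = sumℚ (map (λ S → if cut e S then y st S else 0ℚ) (allSubsets n))

  tight : State → Edge n → Bool
  tight st e = ⌊ load st e ℚP.≟ cost e ⌋

  F : State → List (Edge n)
  F st = filter (λ e → BoolP.T? (tight st e)) E

  reachStep : List (Edge n) → Subset n → Subset n
  reachStep Fs R = tabulate λ x → mem R x ∨
    any (λ { (a , b , _) → (mem R a ∧ (x == b)) ∨ (mem R b ∧ (x == a)) }) Fs

  compIn : List (Edge n) → Fin n → Subset n
  compIn Fs v = iter n (reachStep Fs) ⁅ v ⁆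

  compOf : State → Fin n → Subset n
  compOf st v = compIn (F st) v

  connected : State → Fin n → Fin n → Bool
  connected st u v = mem (compOf st u) v

  demandActive : State → Subset n → Bool
  demandActive st C = any (λ x → mem C x ∧
     any (λ { (a , b) → ((a == x) ∧ not (connected st x b)) ∨ ((b == x) ∧ not (connected st x a)) }) D)
     (allFin n)

  budget : State → Subset n → ℚ
  budget st C = sumℚ (map (λ x → if mem C x then bud st x else 0ℚ) (allFin n))

  budgetActive : State → Subset n → Bool
  budgetActive st C = not (demandActive st C) ∧ ⌊ 0ℚ ℚP.<? budget st C ⌋

  active : State → Subset n → Bool
  active st C = demandActive st C ∨ budgetActive st C

  activeV : State → Fin n → Bool
  activeV st v = active st (compOf st v)

  isActiveComp : State → Subset n → Bool
  isActiveComp st S = any (λ v → (S =S compOf st v) ∧ activeV st v) (allFin n)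

  -- v is the smallest vertex of its component (carries budget changes)
  isRep : State → Fin n → Bool
  isRep st v = all (λ x → not (mem (compOf st v) x ∧ ⌊ x FinP.<? v ⌋)) (allFin n)

  budgetRate : State → Subset n → ℚ
  budgetRate st C = if demandActive st C then ε
                    else (if budgetActive st C then - 1ℚ else 0ℚ)

  edgeCandidates : State → List ℚ
  edgeCandidates st = concatMap cand E
    where
      cand : Edge n → List ℚ
      cand e@(a , b , c) with connected st a b | activeV st a | activeV st b
      ... | true  | _     | _     = []
      ... | false | true  | true  = ((c - load st e) * ½) ∷ []
      ... | false | true  | false = (c - load st e) ∷ []
      ... | false | false | true  = (c - load st e) ∷ []
      ... | false | false | false = []

  budgetCandidates : State → List ℚ
  budgetCandidates st = concatMap
    (λ v → if budgetActive st (compOf st v) then budget st (compOf st v) ∷ [] else [])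
    (allFin n)

  advance : State → ℚ → State
  advance st dt = record
    { time = time st + dt
    ; y    = λ S → y st S + (if isActiveComp st S then dt else 0ℚ)
    ; bud  = λ v → bud st v + (if isRep st v then budgetRate st (compOf st v) * dt else 0ℚ)
    }

  step : State → Maybe State
  step st with minList (edgeCandidates st ++ budgetCandidates st)
  ... | nothing = nothing
  ... | just dt = just (advance st dt)

  initial : State
  initial = record { time = 0ℚ ; y = λ _ → 0ℚ ; bud = λ _ → 0ℚ }

  run : ℕ → State
  run zero    = initial
  run (suc k) = fromMaybe (run k) (step (run k))

  terminal : ℕ → Set
  terminal k = step (run k) ≡ nothing

  PhaseAt : ℚ → ℕ → Set
  PhaseAt t k = time (run k) ≤ t × (terminal k ⊎ t < time (run (suc k)))

  ActiveAt : ℚ → Fin n → Set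
  ActiveAt t v = Σ ℕ λ k → PhaseAt t k × activeV (run k) v ≡ true

  SameComponentAt : ℚ → Fin n → Fin n → Set
  SameComponentAt t u v = Σ ℕ λ k → PhaseAt t k × connected (run k) u v ≡ true

  IsDeactivationTime : Fin n → ℚ∞ → Set
  IsDeactivationTime v τ =
    ((s : ℚ) → 0ℚ ≤ s → s <∞ τ → ActiveAt s v) ×
    ((t : ℚ) → ((s : ℚ) → 0ℚ ≤ s → s < t → ActiveAt s v) → t ≤∞ τ)

  ActivelyConnected : Fin n → Fin n → ℚ∞ → ℚ∞ → Set
  ActivelyConnected u v τu τv =
    Σ ℚ λ t → 0ℚ ≤ t × SameComponentAt t u v × t ≤∞ τu × t ≤∞ τv

-- Components of the tight-edge graph only merge: an edge inside a component is never cut by an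
-- active moat, so its load is frozen and it stays tight. Activity is a property of the component.
-- Hence from the time t at which u and v share a component, u is active exactly when v is, and
-- before t both are active since t ≤ τu and t ≤ τv. So u and v are active at the same times, and
-- a deactivation time is determined by those times.
-- That later phases really are later relies on every edge load staying at most its cost: an edge
-- gains at most one step length per active endpoint, and the step is at most the slack the edge
-- allows, so every step length is nonnegative.

{-# OPTIONS --safe #-}
module Submission where

open import Defs
open import Data.Nat using (ℕ)
open import Data.Fin using (Fin)
open import Data.List using (List)
open import Data.List.Relation.Unary.All using (All)
open import Data.Product using (_×_; _,_)
open import Data.Rational using (ℚ; 0ℚ; _≤_)
open import Relation.Binary.PropositionalEquality using (_≡_)

open import Data.Bool using (Bool; true; false; T; not; _∧_; if_then_else_)
open import Data.Bool.Properties using (T-∨; T-∧; T-≡; T?; if-eta) renaming (_≟_ to _≟ᵇ_)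
open import Data.Empty using (⊥; ⊥-elim)
open import Data.Fin.Subset using (Subset; _∈_; _∉_; _⊆_; _⊂_; ⁅_⁆; ∣_∣)
open import Data.Fin.Subset.Properties using (_∈?_; _⊂?_; ⊆-antisym; p⊂q⇒∣p∣<∣q∣; ∣p∣≤n; ∣⁅x⁆∣≡1; x∈⁅x⁆; x∈⁅y⁆⇒x≡y)
open import Data.List using ([]; _∷_; _++_; map; concatMap; allFin)
open import Data.List.Properties using (map-++; map-∘; map-cong)
open import Data.List.Membership.Propositional using (find; lose) renaming (_∈_ to _∈ˡ_)
open import Data.List.Membership.Propositional.Properties using (∈-filter⁺; ∈-filter⁻)
open import Data.List.Relation.Binary.Subset.Propositional using () renaming (_⊆_ to _⊆ˡ_)
import Data.List.Relation.Unary.All as All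
open import Data.List.Relation.Unary.All.Properties using (++⁺; ++⁻ˡ; concat⁺; concat⁻; map⁺; map⁻)
open import Data.List.Relation.Unary.Any using (here; there)
open import Data.List.Relation.Unary.Any.Properties using (any⁺; any⁻)
open import Data.Maybe using (just; nothing; fromMaybe)
open import Data.Nat using (suc)
import Data.Nat as ℕ
import Data.Nat.Properties as ℕₚ
open import Data.Product using (Σ-syntax; ∃-syntax; proj₁; proj₂)
open import Data.Rational using (_+_; _-_; -_; _*_; _<_; 1ℚ; ½)
open import Data.Rational.Properties using (+-identityˡ; +-identityʳ; +-assoc; +-mono-≤; ≤-refl)
import Data.Rational.Properties as ℚ
open import Data.Rational.Solver using (module +-*-Solver)
open import Data.Sum using (_⊎_; inj₁; inj₂; [_,_]′)
open import Data.Unit using (tt)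
open import Data.Vec using ([]; _∷_; lookup; tabulate)
open import Data.Vec.Properties using (≡-dec; ∷-injectiveʳ; lookup∘tabulate; []=⇒lookup; lookup⇒[]=)
open import Function using (_∘_; id)
open import Function.Bundles using (module Equivalence)
open import Relation.Binary.PropositionalEquality using (_≢_; refl; sym; trans; cong; cong₂; subst; module ≡-Reasoning)
open import Relation.Nullary using (¬_; yes; no)
open import Relation.Nullary.Decidable using (⌊_⌋; toWitness; fromWitness; decidable-stable; toSum)

open Equivalence using (to; from)

if-elim : ∀ {A : Set} (P : A → Set) b {x y : A} → (T b → P x) → (¬ T b → P y) → P (if b then x else y)
if-elim P true  Px _  = Px tt
if-elim P false _  Py = Py id

if-split-∧ : ∀ k a (Y dt : ℚ) →
  (if k then Y + (if a then dt else 0ℚ) else 0ℚ) ≡ (if k then Y else 0ℚ) + (if k ∧ a then dt else 0ℚ)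
if-split-∧ true  a Y dt = refl
if-split-∧ false a Y dt = refl

p≤p+q : ∀ {p q} → 0ℚ ≤ q → p ≤ p + q
p≤p+q {p} {q} 0≤q = subst (_≤ p + q) (+-identityʳ p) (ℚ.+-monoʳ-≤ p 0≤q)

p≤q+p : ∀ {p q} → 0ℚ ≤ q → p ≤ q + p
p≤q+p {p} {q} 0≤q = subst (_≤ q + p) (+-identityˡ p) (ℚ.+-monoˡ-≤ p 0≤q)

p≤q⇒0≤q-p : ∀ {p q} → p ≤ q → 0ℚ ≤ q - p
p≤q⇒0≤q-p {p} {q} p≤q = subst (_≤ q - p) (ℚ.+-inverseʳ p) (ℚ.+-monoˡ-≤ (- p) p≤q)

≤-slack⇒+≤ : ∀ {p q r} → q ≤ r - p → p + q ≤ r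
≤-slack⇒+≤ {p} {q} {r} q≤r-p = subst (p + q ≤_) (p+[r-p]≡r p r) (ℚ.+-monoʳ-≤ p q≤r-p)
  where
  open +-*-Solver
  p+[r-p]≡r : ∀ p r → p + (r - p) ≡ r
  p+[r-p]≡r = solve 2 (λ p r → p :+ (r :- p) := r) refl

half+half : ∀ p → p * ½ + p * ½ ≡ p
half+half = solve 1 (λ p → p :* con ½ :+ p :* con ½ := p) refl
  where open +-*-Solver

sumℚ-++ : ∀ xs ys → sumℚ (xs ++ ys) ≡ sumℚ xs + sumℚ ys
sumℚ-++ []       ys = sym (+-identityˡ (sumℚ ys))
sumℚ-++ (x ∷ xs) ys = trans (cong (x +_) (sumℚ-++ xs ys)) (sym (+-assoc x (sumℚ xs) (sumℚ ys)))

sumℚ-map-+ : ∀ {A : Set} (f g : A → ℚ) xs →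
             sumℚ (map (λ x → f x + g x) xs) ≡ sumℚ (map f xs) + sumℚ (map g xs)
sumℚ-map-+ f g []       = refl
sumℚ-map-+ f g (x ∷ xs) = trans (cong (f x + g x +_) (sumℚ-map-+ f g xs)) (interchange (f x) (g x) _ _)
  where
  open +-*-Solver
  interchange : ∀ a b c d → (a + b) + (c + d) ≡ (a + c) + (b + d)
  interchange = solve 4 (λ a b c d → (a :+ b) :+ (c :+ d) := (a :+ c) :+ (b :+ d)) refl

sumℚ-mono : ∀ {A : Set} {f g : A → ℚ} xs → (∀ x → f x ≤ g x) → sumℚ (map f xs) ≤ sumℚ (map g xs)
sumℚ-mono []       f≤g = ≤-refl
sumℚ-mono (x ∷ xs) f≤g = +-mono-≤ (f≤g x) (sumℚ-mono xs f≤g)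

sumℚ-zero : ∀ {A : Set} {f : A → ℚ} xs → (∀ x → f x ≡ 0ℚ) → sumℚ (map f xs) ≡ 0ℚ
sumℚ-zero []       f≡0 = refl
sumℚ-zero (x ∷ xs) f≡0 = cong₂ _+_ (f≡0 x) (sumℚ-zero xs f≡0)

sumℚ-allSubsets-suc : ∀ {m} (f : Subset (suc m) → ℚ) →
  sumℚ (map f (allSubsets (suc m))) ≡
  sumℚ (map (f ∘ (true ∷_)) (allSubsets m)) + sumℚ (map (f ∘ (false ∷_)) (allSubsets m))
sumℚ-allSubsets-suc {m} f = begin
  sumℚ (map f (map (true ∷_) L ++ map (false ∷_) L))
    ≡⟨ cong sumℚ (map-++ f (map (true ∷_) L) (map (false ∷_) L)) ⟩
  sumℚ (map f (map (true ∷_) L) ++ map f (map (false ∷_) L))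
    ≡⟨ sumℚ-++ (map f (map (true ∷_) L)) (map f (map (false ∷_) L)) ⟩
  sumℚ (map f (map (true ∷_) L)) + sumℚ (map f (map (false ∷_) L))
    ≡⟨ sym (cong₂ _+_ (cong sumℚ (map-∘ L)) (cong sumℚ (map-∘ L))) ⟩
  sumℚ (map (f ∘ (true ∷_)) L) + sumℚ (map (f ∘ (false ∷_)) L) ∎
  where
  open ≡-Reasoning
  L : List (Subset m)
  L = allSubsets m

sumℚ-allSubsets-supported : ∀ {m} (f : Subset m → ℚ) A → (∀ S → S ≢ A → f S ≡ 0ℚ) →
                            sumℚ (map f (allSubsets m)) ≡ f A
sumℚ-allSubsets-supported f [] _ = +-identityʳ (f [])
sumℚ-allSubsets-supported {suc m} f (true ∷ A) f≡0 = begin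
  sumℚ (map f (allSubsets (suc m)))                          ≡⟨ sumℚ-allSubsets-suc f ⟩
  sumℚ (map (f ∘ (true ∷_)) L) + sumℚ (map (f ∘ (false ∷_)) L)
    ≡⟨ cong₂ _+_ (sumℚ-allSubsets-supported (f ∘ (true ∷_)) A (λ S S≢A → f≡0 _ (S≢A ∘ ∷-injectiveʳ)))
                 (sumℚ-zero L (λ S → f≡0 (false ∷ S) λ ())) ⟩
  f (true ∷ A) + 0ℚ                                          ≡⟨ +-identityʳ (f (true ∷ A)) ⟩
  f (true ∷ A)                                               ∎
  where
  open ≡-Reasoning
  L : List (Subset m)
  L = allSubsets m
sumℚ-allSubsets-supported {suc m} f (false ∷ A) f≡0 = begin
  sumℚ (map f (allSubsets (suc m)))                          ≡⟨ sumℚ-allSubsets-suc f ⟩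
  sumℚ (map (f ∘ (true ∷_)) L) + sumℚ (map (f ∘ (false ∷_)) L)
    ≡⟨ cong₂ _+_ (sumℚ-zero L (λ S → f≡0 (true ∷ S) λ ()))
                 (sumℚ-allSubsets-supported (f ∘ (false ∷_)) A (λ S S≢A → f≡0 _ (S≢A ∘ ∷-injectiveʳ))) ⟩
  0ℚ + f (false ∷ A)                                         ≡⟨ +-identityˡ (f (false ∷ A)) ⟩
  f (false ∷ A)                                              ∎
  where
  open ≡-Reasoning
  L : List (Subset m)
  L = allSubsets m

pointMass : ∀ {m} → Subset m → ℚ → Subset m → ℚ
pointMass A α S = if ⌊ ≡-dec _≟ᵇ_ S A ⌋ then α else 0ℚ

pointMass-at : ∀ {m} (A : Subset m) α → pointMass A α A ≡ α
pointMass-at A α with ≡-dec _≟ᵇ_ A A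
... | yes _   = refl
... | no A≢A = ⊥-elim (A≢A refl)

pointMass-nonneg : ∀ {m} (A : Subset m) {α} → 0ℚ ≤ α → ∀ S → 0ℚ ≤ pointMass A α S
pointMass-nonneg A 0≤α S with ≡-dec _≟ᵇ_ S A
... | yes _ = 0≤α
... | no _  = ≤-refl

sumℚ-pointMass : ∀ {m} (A : Subset m) α → sumℚ (map (pointMass A α) (allSubsets m)) ≡ α
sumℚ-pointMass A α = trans (sumℚ-allSubsets-supported (pointMass A α) A outside) (pointMass-at A α)
  where
  outside : ∀ S → S ≢ A → pointMass A α S ≡ 0ℚ
  outside S S≢A with ≡-dec _≟ᵇ_ S A
  ... | yes S≡A = ⊥-elim (S≢A S≡A)
  ... | no _    = refl

minList-nothing : ∀ qs → minList qs ≡ nothing → qs ≡ []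
minList-nothing []       _ = refl
minList-nothing (q ∷ qs) h with minList qs
minList-nothing (q ∷ qs) () | nothing
minList-nothing (q ∷ qs) () | just _

minList-lowerBound : ∀ qs {m} → minList qs ≡ just m → All (m ≤_) qs
minList-lowerBound (q ∷ qs) h with minList qs in eq
minList-lowerBound (q ∷ qs) refl | nothing rewrite minList-nothing qs eq = ≤-refl All.∷ All.[]
minList-lowerBound (q ∷ qs) refl | just m =
  ℚ.p⊓q≤p q m All.∷ All.map (ℚ.≤-trans (ℚ.p⊓q≤q q m)) (minList-lowerBound qs eq)

minList-∈ : ∀ qs {m} → minList qs ≡ just m → m ∈ˡ qs
minList-∈ (q ∷ qs) h with minList qs in eq
minList-∈ (q ∷ qs) refl | nothing = here refl
minList-∈ (q ∷ qs) refl | just m with ℚ.⊓-sel q m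
... | inj₁ q⊓m≡q = here q⊓m≡q
... | inj₂ q⊓m≡m = there (subst (_∈ˡ qs) (sym q⊓m≡m) (minList-∈ qs eq))

IsDeactivationTimeOf : (ℚ → Set) → ℚ∞ → Set
IsDeactivationTimeOf P τ =
  ((s : ℚ) → 0ℚ ≤ s → s <∞ τ → P s) ×
  ((t : ℚ) → ((s : ℚ) → 0ℚ ≤ s → s < t → P s) → t ≤∞ τ)

IsDeactivationTimeOf-resp : ∀ {P Q : ℚ → Set} {τ} →
  (∀ s → 0ℚ ≤ s → P s → Q s) → (∀ s → 0ℚ ≤ s → Q s → P s) →
  IsDeactivationTimeOf P τ → IsDeactivationTimeOf Q τ
IsDeactivationTimeOf-resp P⇒Q Q⇒P (before , maximal) =
  (λ s 0≤s s<τ → P⇒Q s 0≤s (before s 0≤s s<τ)) ,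
  (λ t Q<t → maximal t (λ s 0≤s s<t → Q⇒P s 0≤s (Q<t s 0≤s s<t)))

p+1≰p : ∀ p → p + 1ℚ ≤ p → ⊥
p+1≰p p p+1≤p = ℚ.<-irrefl refl (ℚ.<-≤-trans p<p+1 p+1≤p)
  where
  p<p+1 : p < p + 1ℚ
  p<p+1 = subst (_< p + 1ℚ) (+-identityʳ p) (ℚ.+-monoʳ-< p (ℚ.positive⁻¹ 1ℚ))

deactivationTime-unique : ∀ {P : ℚ → Set} τ₁ τ₂ →
  IsDeactivationTimeOf P τ₁ → IsDeactivationTimeOf P τ₂ → τ₁ ≡ τ₂
deactivationTime-unique (fin a) (fin b) (before₁ , maximal₁) (before₂ , maximal₂) =
  cong fin (ℚ.≤-antisym (maximal₂ a before₁) (maximal₁ b before₂))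
deactivationTime-unique (fin a) ∞ (_ , maximal₁) (before₂ , _) =
  ⊥-elim (p+1≰p a (maximal₁ (a + 1ℚ) (λ s 0≤s _ → before₂ s 0≤s tt)))
deactivationTime-unique ∞ (fin b) (before₁ , _) (_ , maximal₂) =
  ⊥-elim (p+1≰p b (maximal₂ (b + 1ℚ) (λ s 0≤s _ → before₁ s 0≤s tt)))
deactivationTime-unique ∞ ∞ _ _ = refl

<-≤∞-trans : ∀ {s t} τ → s < t → t ≤∞ τ → s <∞ τ
<-≤∞-trans (fin q) s<t t≤q = ℚ.<-≤-trans s<t t≤q
<-≤∞-trans ∞       _   _   = tt

≤-induction : ∀ {P : ℕ → Set} → (∀ k → P k → P (suc k)) → ∀ {k k′} → k ℕ.≤ k′ → P k → P k′
≤-induction {P} step = go ∘ ℕₚ.≤⇒≤′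
  where
  go : ∀ {k k′} → k ℕ.≤′ k′ → P k → P k′
  go ℕ.≤′-refl          Pk = Pk
  go (ℕ.≤′-step k≤′k′) Pk = step _ (go k≤′k′ Pk)

⊆⇒⊇⊎⊂ : ∀ {m} {p q : Subset m} → p ⊆ q → q ⊆ p ⊎ p ⊂ q
⊆⇒⊇⊎⊂ {p = p} {q} p⊆q with p ⊂? q
... | yes p⊂q = inj₂ p⊂q
... | no  p⊄q = inj₁ λ {x} x∈q → decidable-stable (x ∈? p) (λ x∉p → p⊄q (p⊆q , x , x∈q , x∉p))

T-lookup⇒∈ : ∀ {m} {S : Subset m} {x} → T (lookup S x) → x ∈ S
T-lookup⇒∈ {S = S} {x} h = lookup⇒[]= x S (to T-≡ h)

∈⇒T-lookup : ∀ {m} {S : Subset m} {x} → x ∈ S → T (lookup S x)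
∈⇒T-lookup x∈S = from T-≡ ([]=⇒lookup x∈S)

lookup≡false⇒∉ : ∀ {m} {S : Subset m} {x} → lookup S x ≡ false → x ∉ S
lookup≡false⇒∉ x∉S x∈S with () ← trans (sym ([]=⇒lookup x∈S)) x∉S

∈-tabulate⁻ : ∀ {m} {f : Fin m → Bool} {x} → x ∈ tabulate f → T (f x)
∈-tabulate⁻ {f = f} {x} x∈ = subst T (lookup∘tabulate f x) (∈⇒T-lookup x∈)

∈-tabulate⁺ : ∀ {m} {f : Fin m → Bool} {x} → T (f x) → x ∈ tabulate f
∈-tabulate⁺ {f = f} {x} h = T-lookup⇒∈ (subst T (sym (lookup∘tabulate f x)) h)

module MoatGrowingProperties (n : ℕ) (E : List (Edge n)) (D : List (Fin n × Fin n)) (ε : ℚ) where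
  open MoatGrowing n E D ε

  Enters : Subset n → Fin n → Edge n → Set
  Enters R x (a , b , _) = a ∈ R × x ≡ b ⊎ b ∈ R × x ≡ a

  Enters-mono : ∀ {R R′ x e} → R ⊆ R′ → Enters R x e → Enters R′ x e
  Enters-mono R⊆R′ (inj₁ (a∈R , x≡b)) = inj₁ (R⊆R′ a∈R , x≡b)
  Enters-mono R⊆R′ (inj₂ (b∈R , x≡a)) = inj₂ (R⊆R′ b∈R , x≡a)

  reachStep-⊇ : ∀ Fs {R} → R ⊆ reachStep Fs R
  reachStep-⊇ Fs x∈R = ∈-tabulate⁺ (from T-∨ (inj₁ (∈⇒T-lookup x∈R)))

  reachStep-enter : ∀ {Fs} R {x e} → e ∈ˡ Fs → Enters R x e → x ∈ reachStep Fs R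
  reachStep-enter {Fs} R {x} {a , b , c} e∈Fs entry =
    ∈-tabulate⁺ (from T-∨ (inj₂ (any⁺ _ (lose e∈Fs (from T-∨ (edgeTest entry))))))
    where
    edgeTest : Enters R x (a , b , c) → T (lookup R a ∧ (x == b)) ⊎ T (lookup R b ∧ (x == a))
    edgeTest (inj₁ (a∈R , refl)) = inj₁ (from T-∧ (∈⇒T-lookup a∈R , fromWitness refl))
    edgeTest (inj₂ (b∈R , refl)) = inj₂ (from T-∧ (∈⇒T-lookup b∈R , fromWitness refl))

  reachStep⁻ : ∀ Fs R {x} → x ∈ reachStep Fs R → x ∈ R ⊎ ∃[ e ] e ∈ˡ Fs × Enters R x e
  reachStep⁻ Fs R {x} x∈ with to T-∨ (∈-tabulate⁻ x∈)
  ... | inj₁ x∈R = inj₁ (T-lookup⇒∈ x∈R)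
  ... | inj₂ h with find (any⁻ _ Fs h)
  ... | (a , b , c) , e∈Fs , entry = inj₂ ((a , b , c) , e∈Fs , fromEdgeTest (to T-∨ entry))
    where
    fromEdgeTest : T (lookup R a ∧ (x == b)) ⊎ T (lookup R b ∧ (x == a)) → Enters R x (a , b , c)
    fromEdgeTest (inj₁ h) = let a∈R , x≡b = to T-∧ h in inj₁ (T-lookup⇒∈ a∈R , toWitness x≡b)
    fromEdgeTest (inj₂ h) = let b∈R , x≡a = to T-∧ h in inj₂ (T-lookup⇒∈ b∈R , toWitness x≡a)

  reachStep-mono : ∀ {Fs Fs′ R R′} → Fs ⊆ˡ Fs′ → R ⊆ R′ → reachStep Fs R ⊆ reachStep Fs′ R′
  reachStep-mono {Fs} {Fs′} {R} {R′} Fs⊆Fs′ R⊆R′ {x} x∈ with reachStep⁻ Fs R x∈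
  ... | inj₁ x∈R                = reachStep-⊇ Fs′ (R⊆R′ x∈R)
  ... | inj₂ (e , e∈Fs , entry) = reachStep-enter R′ (Fs⊆Fs′ e∈Fs) (Enters-mono {x = x} {e} R⊆R′ entry)

  Closed : List (Edge n) → Subset n → Set
  Closed Fs C = reachStep Fs C ⊆ C

  Closed-reachStep : ∀ {Fs C} → Closed Fs C → Closed Fs (reachStep Fs C)
  Closed-reachStep {Fs} {C} closed = reachStep-mono {Fs} {Fs} {reachStep Fs C} {C} id closed

  Closed-antitone : ∀ {Fs Fs′ C} → Fs ⊆ˡ Fs′ → Closed Fs′ C → Closed Fs C
  Closed-antitone {C = C} Fs⊆Fs′ closed = closed ∘ reachStep-mono {R = C} {C} Fs⊆Fs′ id

  layer : List (Edge n) → Fin n → ℕ → Subset n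
  layer Fs v k = iter k (reachStep Fs) ⁅ v ⁆

  -- a layer that is not closed is strictly contained in the next, and subsets of Fin n have at most n elements
  layer-closed⊎large : ∀ Fs v k → Closed Fs (layer Fs v k) ⊎ k ℕ.< ∣ layer Fs v k ∣
  layer-closed⊎large Fs v ℕ.zero = inj₂ (ℕₚ.≤-reflexive (sym (∣⁅x⁆∣≡1 v)))
  layer-closed⊎large Fs v (suc k) with layer-closed⊎large Fs v k
  ... | inj₁ closed = inj₁ (Closed-reachStep {Fs} {layer Fs v k} closed)
  ... | inj₂ k<∣L∣ with ⊆⇒⊇⊎⊂ (reachStep-⊇ Fs {layer Fs v k})
  ...   | inj₁ closed = inj₁ (Closed-reachStep {Fs} {layer Fs v k} closed)
  ...   | inj₂ L⊂L′   = inj₂ (ℕₚ.≤-trans (ℕ.s≤s k<∣L∣) (p⊂q⇒∣p∣<∣q∣ L⊂L′))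

  compIn-closed : ∀ Fs v → Closed Fs (compIn Fs v)
  compIn-closed Fs v with layer-closed⊎large Fs v n
  ... | inj₁ closed = closed
  ... | inj₂ n<∣C∣  = ⊥-elim (ℕₚ.<⇒≱ n<∣C∣ (∣p∣≤n (compIn Fs v)))

  compIn-self : ∀ Fs v → v ∈ compIn Fs v
  compIn-self Fs v = go n
    where
    go : ∀ k → v ∈ layer Fs v k
    go ℕ.zero    = x∈⁅x⁆ v
    go (suc k) = reachStep-⊇ Fs (go k)

  compIn-least : ∀ Fs {v C} → Closed Fs C → v ∈ C → compIn Fs v ⊆ C
  compIn-least Fs {v} {C} closed v∈C = go n
    where
    go : ∀ k → layer Fs v k ⊆ C
    go ℕ.zero    x∈ rewrite x∈⁅y⁆⇒x≡y v x∈ = v∈C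
    go (suc k) x∈ = closed (reachStep-mono {Fs} {Fs} {layer Fs v k} {C} id (go k) x∈)

  compIn-mono : ∀ {Fs Fs′} v → Fs ⊆ˡ Fs′ → compIn Fs v ⊆ compIn Fs′ v
  compIn-mono {Fs} {Fs′} v Fs⊆Fs′ =
    compIn-least Fs (Closed-antitone {C = compIn Fs′ v} Fs⊆Fs′ (compIn-closed Fs′ v)) (compIn-self Fs′ v)

  compIn-⊆ : ∀ Fs {u} v → u ∈ compIn Fs v → compIn Fs u ⊆ compIn Fs v
  compIn-⊆ Fs v = compIn-least Fs (compIn-closed Fs v)

  compIn-enter : ∀ Fs v {x e} → e ∈ˡ Fs → Enters (compIn Fs v) x e → x ∈ compIn Fs v
  compIn-enter Fs v e∈Fs entry = compIn-closed Fs v (reachStep-enter (compIn Fs v) e∈Fs entry)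

  -- the vertices whose component contains v form a closed set containing v
  compIn-sym : ∀ Fs {u} v → u ∈ compIn Fs v → v ∈ compIn Fs u
  compIn-sym Fs v u∈ = ∈R⇒v∈ (compIn-least Fs closed (v∈⇒∈R (compIn-self Fs v)) u∈)
    where
    R : Subset n
    R = tabulate λ x → lookup (compIn Fs x) v

    v∈⇒∈R : ∀ {x} → v ∈ compIn Fs x → x ∈ R
    v∈⇒∈R = ∈-tabulate⁺ ∘ ∈⇒T-lookup

    ∈R⇒v∈ : ∀ {x} → x ∈ R → v ∈ compIn Fs x
    ∈R⇒v∈ = T-lookup⇒∈ ∘ ∈-tabulate⁻

    closed : Closed Fs R
    closed x∈ with reachStep⁻ Fs R x∈
    ... | inj₁ x∈R = x∈R
    ... | inj₂ ((a , b , c) , e∈Fs , inj₁ (a∈R , refl)) =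
      v∈⇒∈R (compIn-⊆ Fs b (compIn-enter Fs b e∈Fs (inj₂ (compIn-self Fs b , refl))) (∈R⇒v∈ a∈R))
    ... | inj₂ ((a , b , c) , e∈Fs , inj₂ (b∈R , refl)) =
      v∈⇒∈R (compIn-⊆ Fs a (compIn-enter Fs a e∈Fs (inj₁ (compIn-self Fs a , refl))) (∈R⇒v∈ b∈R))

  compIn-≡ : ∀ Fs {u} v → u ∈ compIn Fs v → compIn Fs u ≡ compIn Fs v
  compIn-≡ Fs v u∈ = ⊆-antisym (compIn-⊆ Fs v u∈) (compIn-⊆ Fs _ (compIn-sym Fs v u∈))

  connected⇒∈ : ∀ st {u v} → connected st u v ≡ true → v ∈ compOf st u
  connected⇒∈ st {u} {v} = lookup⇒[]= v (compOf st u)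

  ∈⇒connected : ∀ st {u v} → v ∈ compOf st u → connected st u v ≡ true
  ∈⇒connected st = []=⇒lookup

  connected-sym : ∀ st {u v} → connected st u v ≡ true → connected st v u ≡ true
  connected-sym st {u} {v} uv = ∈⇒connected st (compIn-sym (F st) u (connected⇒∈ st uv))

  activeV-cong : ∀ st {u v} → v ∈ compOf st u → activeV st u ≡ activeV st v
  activeV-cong st {u} v∈ = cong (active st) (sym (compIn-≡ (F st) u v∈))

  activeComp⁻ : ∀ st {S x} → T (isActiveComp st S) → x ∈ S → S ≡ compOf st x × activeV st x ≡ true
  activeComp⁻ st {S} {x} h x∈S = trans S≡w (sym x≡w) , trans (cong (active st) x≡w) w-active
    where
    witness : ∃[ w ] w ∈ˡ allFin n × T ((S =S compOf st w) ∧ activeV st w)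
    witness = find (any⁻ _ (allFin n) h)

    w : Fin n
    w = proj₁ witness

    S≡w : S ≡ compOf st w
    S≡w = toWitness {a? = ≡-dec _≟ᵇ_ S (compOf st w)} (proj₁ (to T-∧ (proj₂ (proj₂ witness))))

    w-active : activeV st w ≡ true
    w-active = to T-≡ (proj₂ (to T-∧ (proj₂ (proj₂ witness))))

    x≡w : compOf st x ≡ compOf st w
    x≡w = compIn-≡ (F st) w (subst (x ∈_) S≡w x∈S)

  cut⁻ : ∀ {a b c S} → T (cut (a , b , c) S) → a ∈ S × b ∉ S ⊎ b ∈ S × a ∉ S
  cut⁻ {a} {b} {c} {S} h with lookup S a in a∈S | lookup S b in b∈S
  ... | true  | false = inj₁ (lookup⇒[]= a S a∈S , lookup≡false⇒∉ b∈S)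
  ... | false | true  = inj₂ (lookup⇒[]= b S b∈S , lookup≡false⇒∉ a∈S)
  ... | true  | true  = ⊥-elim h
  ... | false | false = ⊥-elim h

  growth : State → ℚ → Edge n → ℚ
  growth st dt e = sumℚ (map (λ S → if cut e S ∧ isActiveComp st S then dt else 0ℚ) (allSubsets n))

  load-advance : ∀ st dt e → load (advance st dt) e ≡ load st e + growth st dt e
  load-advance st dt e = trans (cong sumℚ (map-cong split (allSubsets n))) (sumℚ-map-+ _ _ (allSubsets n))
    where
    split : ∀ S → (if cut e S then y st S + (if isActiveComp st S then dt else 0ℚ) else 0ℚ) ≡
                  (if cut e S then y st S else 0ℚ) + (if cut e S ∧ isActiveComp st S then dt else 0ℚ)
    split S = if-split-∧ (cut e S) (isActiveComp st S) (y st S) dt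

  growth-connected : ∀ st dt {a b c} → b ∈ compOf st a → growth st dt (a , b , c) ≡ 0ℚ
  growth-connected st dt {a} {b} {c} b∈a =
    sumℚ-zero (allSubsets n) (λ S → if-elim (_≡ 0ℚ) (cut (a , b , c) S ∧ isActiveComp st S)
                                              (⊥-elim ∘ noActiveCut S) (λ _ → refl))
    where
    noActiveCut : ∀ S → ¬ T (cut (a , b , c) S ∧ isActiveComp st S)
    noActiveCut S h = [ (λ (a∈S , b∉S) → b∉S (subst (b ∈_) (sym (S≡ a∈S)) b∈a))
                      , (λ (b∈S , a∉S) → a∉S (subst (a ∈_) (sym (S≡ b∈S)) (compIn-sym (F st) a b∈a)))
                      ]′ (cut⁻ {a} {b} {c} {S} (proj₁ (to T-∧ h)))
      where
      S≡ : ∀ {x} → x ∈ S → S ≡ compOf st x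
      S≡ = proj₁ ∘ activeComp⁻ st (proj₂ (to T-∧ h))

  load-advance-inside : ∀ st dt {a b} c → b ∈ compOf st a →
                        load (advance st dt) (a , b , c) ≡ load st (a , b , c)
  load-advance-inside st dt {a} {b} c b∈a = begin
    load (advance st dt) (a , b , c)               ≡⟨ load-advance st dt (a , b , c) ⟩
    load st (a , b , c) + growth st dt (a , b , c)
      ≡⟨ cong (load st (a , b , c) +_) (growth-connected st dt {c = c} b∈a) ⟩
    load st (a , b , c) + 0ℚ                       ≡⟨ +-identityʳ _ ⟩
    load st (a , b , c)                            ∎
    where open ≡-Reasoning

  moatGrowth : State → ℚ → Fin n → ℚ
  moatGrowth st dt x = if activeV st x then dt else 0ℚ

  moatGrowth-nonneg : ∀ st {dt} x → 0ℚ ≤ dt → 0ℚ ≤ moatGrowth st dt x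
  moatGrowth-nonneg st x 0≤dt = if-elim (0ℚ ≤_) (activeV st x) (λ _ → 0≤dt) (λ _ → ≤-refl)

  massAt : State → ℚ → Fin n → Subset n → ℚ
  massAt st dt x = pointMass (compOf st x) (moatGrowth st dt x)

  massAt-active : ∀ st dt {x S} → T (isActiveComp st S) → x ∈ S → massAt st dt x S ≡ dt
  massAt-active st dt {x} {S} activeS x∈S = begin
    massAt st dt x S                                          ≡⟨ cong (massAt st dt x) S≡x ⟩
    pointMass (compOf st x) (moatGrowth st dt x) (compOf st x) ≡⟨ pointMass-at (compOf st x) (moatGrowth st dt x) ⟩
    moatGrowth st dt x                                        ≡⟨ cong (if_then dt else 0ℚ) x-active ⟩
    dt                                                        ∎
    where
    open ≡-Reasoning

    S≡x : S ≡ compOf st x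
    S≡x = proj₁ (activeComp⁻ st activeS x∈S)

    x-active : activeV st x ≡ true
    x-active = proj₂ (activeComp⁻ st activeS x∈S)

  massAt-nonneg : ∀ st {dt} → 0ℚ ≤ dt → ∀ x S → 0ℚ ≤ massAt st dt x S
  massAt-nonneg st 0≤dt x = pointMass-nonneg (compOf st x) (moatGrowth-nonneg st x 0≤dt)

  -- an active set cut by (a , b , c) is the component of a or of b, and then that endpoint is active
  growth-bound : ∀ st {dt} a b c → 0ℚ ≤ dt → growth st dt (a , b , c) ≤ moatGrowth st dt a + moatGrowth st dt b
  growth-bound st {dt} a b c 0≤dt = begin
    growth st dt (a , b , c)                                           ≤⟨ sumℚ-mono (allSubsets n) pointwise ⟩
    sumℚ (map (λ S → massAt st dt a S + massAt st dt b S) (allSubsets n))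
      ≡⟨ sumℚ-map-+ (massAt st dt a) (massAt st dt b) (allSubsets n) ⟩
    sumℚ (map (massAt st dt a) (allSubsets n)) + sumℚ (map (massAt st dt b) (allSubsets n))
      ≡⟨ cong₂ _+_ (sumℚ-pointMass (compOf st a) (moatGrowth st dt a))
                   (sumℚ-pointMass (compOf st b) (moatGrowth st dt b)) ⟩
    moatGrowth st dt a + moatGrowth st dt b                            ∎
    where
    open ℚ.≤-Reasoning

    activeCut : ∀ S → T (cut (a , b , c) S ∧ isActiveComp st S) → dt ≤ massAt st dt a S + massAt st dt b S
    activeCut S h = [ (λ (a∈S , _) → subst (λ m → dt ≤ m + massAt st dt b S)
                                           (sym (massAt-active st dt activeS a∈S))
                                           (p≤p+q (massAt-nonneg st 0≤dt b S)))
                    , (λ (b∈S , _) → subst (λ m → dt ≤ massAt st dt a S + m)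
                                           (sym (massAt-active st dt activeS b∈S))
                                           (p≤q+p (massAt-nonneg st 0≤dt a S)))
                    ]′ (cut⁻ {a} {b} {c} {S} (proj₁ (to T-∧ h)))
      where
      activeS : T (isActiveComp st S)
      activeS = proj₂ (to T-∧ h)

    pointwise : ∀ S → (if cut (a , b , c) S ∧ isActiveComp st S then dt else 0ℚ) ≤
                      massAt st dt a S + massAt st dt b S
    pointwise S = if-elim (_≤ massAt st dt a S + massAt st dt b S) (cut (a , b , c) S ∧ isActiveComp st S)
                    (activeCut S) (λ _ → +-mono-≤ (massAt-nonneg st 0≤dt a S) (massAt-nonneg st 0≤dt b S))

  load-advance-across : ∀ st {dt} a b c → 0ℚ ≤ dt →
    load (advance st dt) (a , b , c) ≤ load st (a , b , c) + (moatGrowth st dt a + moatGrowth st dt b)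
  load-advance-across st {dt} a b c 0≤dt = begin
    load (advance st dt) (a , b , c)               ≡⟨ load-advance st dt (a , b , c) ⟩
    load st (a , b , c) + growth st dt (a , b , c)
      ≤⟨ ℚ.+-monoʳ-≤ (load st (a , b , c)) (growth-bound st a b c 0≤dt) ⟩
    load st (a , b , c) + (moatGrowth st dt a + moatGrowth st dt b) ∎
    where open ℚ.≤-Reasoning

  -- edgeCandidates st is concatMap over E of a function local to its where block; unification names it
  perEdgeCandidates : (st : State) → Σ[ f ∈ (Edge n → List ℚ) ] edgeCandidates st ≡ concatMap f E
  perEdgeCandidates st = _ , refl

  edgeCandidate : State → Edge n → List ℚ
  edgeCandidate st = proj₁ (perEdgeCandidates st)

  edgeCandidate-nonneg : ∀ st a b c → load st (a , b , c) ≤ c → All (0ℚ ≤_) (edgeCandidate st (a , b , c))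
  edgeCandidate-nonneg st a b c l≤c with connected st a b | activeV st a | activeV st b
  ... | true  | _     | _     = All.[]
  ... | false | true  | true  = ℚ.*-monoʳ-≤-nonNeg ½ (p≤q⇒0≤q-p l≤c) All.∷ All.[]
  ... | false | true  | false = p≤q⇒0≤q-p l≤c All.∷ All.[]
  ... | false | false | true  = p≤q⇒0≤q-p l≤c All.∷ All.[]
  ... | false | false | false = All.[]

  edgeCandidate-sound : ∀ st dt a b c → ¬ T (connected st a b) → load st (a , b , c) ≤ c →
                        All (dt ≤_) (edgeCandidate st (a , b , c)) →
                        load st (a , b , c) + (moatGrowth st dt a + moatGrowth st dt b) ≤ c
  edgeCandidate-sound st dt a b c ¬ab l≤c dt≤ with connected st a b | activeV st a | activeV st b
  ... | true  | _     | _     = ⊥-elim (¬ab tt)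
  ... | false | true  | true  =
    ≤-slack⇒+≤ (subst (dt + dt ≤_) (half+half _) (+-mono-≤ (All.head dt≤) (All.head dt≤)))
  ... | false | true  | false = ≤-slack⇒+≤ (subst (_≤ c - _) (sym (+-identityʳ dt)) (All.head dt≤))
  ... | false | false | true  = ≤-slack⇒+≤ (subst (_≤ c - _) (sym (+-identityˡ dt)) (All.head dt≤))
  ... | false | false | false = subst (_≤ c) (sym (+-identityʳ _)) l≤c

  budgetCandidates-nonneg : ∀ st → All (0ℚ ≤_) (budgetCandidates st)
  budgetCandidates-nonneg st =
    concat⁺ (map⁺ (All.tabulate {xs = allFin n} λ {v} _ → budgetCandidate-nonneg (compOf st v)))
    where
    budgetCandidate-nonneg : ∀ C → All (0ℚ ≤_) (if budgetActive st C then budget st C ∷ [] else [])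
    budgetCandidate-nonneg C = if-elim (All (0ℚ ≤_)) (budgetActive st C)
      (λ h → ℚ.<⇒≤ (toWitness {a? = 0ℚ ℚ.<? budget st C} (proj₂ (to (T-∧ {not (demandActive st C)}) h)))
             All.∷ All.[])
      (λ _ → All.[])

  candidates : State → List ℚ
  candidates st = edgeCandidates st ++ budgetCandidates st

  Feasible : State → Set
  Feasible st = ∀ {e} → e ∈ˡ E → load st e ≤ cost e

  candidates-nonneg : ∀ st → Feasible st → All (0ℚ ≤_) (candidates st)
  candidates-nonneg st feasible =
    ++⁺ (concat⁺ (map⁺ {f = edgeCandidate st} (All.tabulate {xs = E} λ { {a , b , c} e∈E →
                                                   edgeCandidate-nonneg st a b c (feasible e∈E) })))
        (budgetCandidates-nonneg st)

  step-nonneg : ∀ st {dt} → Feasible st → minList (candidates st) ≡ just dt → 0ℚ ≤ dt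
  step-nonneg st feasible min≡dt = All.lookup (candidates-nonneg st feasible) (minList-∈ _ min≡dt)

  advance-feasible : ∀ st dt → Feasible st → minList (candidates st) ≡ just dt → Feasible (advance st dt)
  advance-feasible st dt feasible min≡dt {a , b , c} e∈E =
    [ (λ ab → subst (_≤ c) (sym (load-advance-inside st dt c (connected⇒∈ st (to T-≡ ab)))) (feasible e∈E))
    , (λ ¬ab → ℚ.≤-trans (load-advance-across st a b c (step-nonneg st feasible min≡dt))
                         (edgeCandidate-sound st dt a b c ¬ab (feasible e∈E) dt≤candidate))
    ]′ (toSum (T? (connected st a b)))
    where
    dt≤candidate : All (dt ≤_) (edgeCandidate st (a , b , c))
    dt≤candidate = All.lookup (map⁻ {f = edgeCandidate st}
                                    (concat⁻ (++⁻ˡ (edgeCandidates st) (minList-lowerBound _ min≡dt)))) e∈E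

  run-suc : ∀ k → run (suc k) ≡ run k ⊎
                  ∃[ dt ] minList (candidates (run k)) ≡ just dt × run (suc k) ≡ advance (run k) dt
  run-suc k with minList (candidates (run k))
  ... | nothing = inj₁ refl
  ... | just dt = inj₂ (dt , refl , refl)

  run-terminal : ∀ {k k′} → terminal k → k ℕ.≤ k′ → run k′ ≡ run k
  run-terminal {k} term k≤k′ = ≤-induction {P = λ j → run j ≡ run k} stays k≤k′ refl
    where
    stays : ∀ j → run j ≡ run k → run (suc j) ≡ run k
    stays j j≡k = trans (cong (λ st → fromMaybe st (step st)) j≡k) (cong (fromMaybe (run k)) term)

  F-advance : ∀ st dt → F st ⊆ˡ F (advance st dt)
  F-advance st dt {a , b , c} e∈F = ∈-filter⁺ (T? ∘ tight (advance st dt)) e∈E (subst T (sym tight≡) tightE)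
    where
    e∈E : (a , b , c) ∈ˡ E
    e∈E = proj₁ (∈-filter⁻ (T? ∘ tight st) {xs = E} e∈F)

    tightE : T (tight st (a , b , c))
    tightE = proj₂ (∈-filter⁻ (T? ∘ tight st) {xs = E} e∈F)

    tight≡ : tight (advance st dt) (a , b , c) ≡ tight st (a , b , c)
    tight≡ = cong (λ l → ⌊ l ℚ.≟ c ⌋)
                  (load-advance-inside st dt c (compIn-enter (F st) a e∈F (inj₁ (compIn-self (F st) a , refl))))

  connected-advance : ∀ st dt {u v} → connected st u v ≡ true → connected (advance st dt) u v ≡ true
  connected-advance st dt {u} uv = ∈⇒connected (advance st dt) (compIn-mono u (F-advance st dt) (connected⇒∈ st uv))

  connected-run : ∀ {k k′ u v} → k ℕ.≤ k′ → connected (run k) u v ≡ true → connected (run k′) u v ≡ true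
  connected-run {u = u} {v} = ≤-induction {P = λ j → connected (run j) u v ≡ true} persists
    where
    persists : ∀ j → connected (run j) u v ≡ true → connected (run (suc j)) u v ≡ true
    persists j uv = [ (λ run≡ → subst (λ st → connected st u v ≡ true) (sym run≡) uv)
                    , (λ (dt , _ , run≡) → subst (λ st → connected st u v ≡ true) (sym run≡)
                                                 (connected-advance (run j) dt uv))
                    ]′ (run-suc j)

  load-initial : ∀ e → load initial e ≡ 0ℚ
  load-initial e = sumℚ-zero (allSubsets n) (λ S → if-eta (cut e S))

  module _ (cost-nonneg : All (λ e → 0ℚ ≤ cost e) E) where

    run-feasible : ∀ k → Feasible (run k)
    run-feasible ℕ.zero    {e} e∈E = subst (_≤ cost e) (sym (load-initial e)) (All.lookup cost-nonneg e∈E)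
    run-feasible (suc k) = [ (λ run≡ → subst Feasible (sym run≡) (run-feasible k))
                           , (λ (dt , min≡dt , run≡) → subst Feasible (sym run≡)
                                                           (advance-feasible (run k) dt (run-feasible k) min≡dt))
                           ]′ (run-suc k)

    time-run-mono : ∀ {k k′} → k ℕ.≤ k′ → time (run k) ≤ time (run k′)
    time-run-mono {k} k≤k′ = ≤-induction {P = λ j → time (run k) ≤ time (run j)} later k≤k′ ≤-refl
      where
      later : ∀ j → time (run k) ≤ time (run j) → time (run k) ≤ time (run (suc j))
      later j k≤j = ℚ.≤-trans k≤j
        ([ (λ run≡ → ℚ.≤-reflexive (cong time (sym run≡)))
         , (λ (dt , min≡dt , run≡) → subst (λ st → time (run j) ≤ time st) (sym run≡)
                                           (p≤p+q (step-nonneg (run j) (run-feasible j) min≡dt)))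
         ]′ (run-suc j))

    phase-before-terminal : ∀ {s k k′} → PhaseAt s k′ → time (run k) ≤ s → k′ ℕ.< k → terminal k′
    phase-before-terminal {s} (_ , k′-ends) tₖ≤s k′<k =
      [ id
      , (λ s<tₖ′₊₁ → ⊥-elim (ℚ.<-irrefl refl (ℚ.<-≤-trans s<tₖ′₊₁ (ℚ.≤-trans (time-run-mono k′<k) tₖ≤s))))
      ]′ k′-ends

    -- components only grow along the run; a phase k′ < k containing a time after t_k is the last one
    connected-later : ∀ {t s k k′ u v} → PhaseAt t k → PhaseAt s k′ → t ≤ s →
                      connected (run k) u v ≡ true → connected (run k′) u v ≡ true
    connected-later {s = s} {k} {k′} {u} {v} (tₖ≤t , _) phase′ t≤s uv =
      [ (λ k≤k′ → connected-run k≤k′ uv)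
      , (λ k≰k′ → subst (λ st → connected st u v ≡ true)
                        (run-terminal {k′} {k}
                          (phase-before-terminal {s} {k} {k′} phase′ (ℚ.≤-trans tₖ≤t t≤s) (ℕₚ.≰⇒> k≰k′))
                          (ℕₚ.<⇒≤ (ℕₚ.≰⇒> k≰k′)))
                        uv)
      ]′ (toSum (k ℕ.≤? k′))

    activeAt-partner : ∀ {t k u v τ} → IsDeactivationTime u τ → t ≤∞ τ → PhaseAt t k →
                       connected (run k) u v ≡ true → ∀ s → 0ℚ ≤ s → ActiveAt s v → ActiveAt s u
    activeAt-partner {t} {k} {u} {v} {τ} (before , _) t≤τ phase uv s 0≤s (k′ , phase′ , v-active) =
      [ (λ s<t → before s 0≤s (<-≤∞-trans τ s<t t≤τ))
      , (λ s≮t → k′ , phase′ , trans (activeV-cong (run k′) (connected⇒∈ (run k′) (uv-later s≮t))) v-active)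
      ]′ (toSum (s ℚ.<? t))
      where
      uv-later : ¬ s < t → connected (run k′) u v ≡ true
      uv-later s≮t = connected-later {t} {s} {k} {k′} phase phase′ (ℚ.≮⇒≥ s≮t) uv

-- The sign of ε is irrelevant: budget candidates are positive by the definition of budget-activity.
mainTheorem5 : (n : ℕ) (E : List (Edge n)) (D : List (Fin n × Fin n)) (ε : ℚ)
    → 0ℚ ≤ ε
    → All (λ { (_ , _ , c) → 0ℚ ≤ c }) E
    → (u v : Fin n) (τu τv : ℚ∞)
    → MoatGrowing.IsDeactivationTime n E D ε u τu
    → MoatGrowing.IsDeactivationTime n E D ε v τv
    → MoatGrowing.ActivelyConnected n E D ε u v τu τv
    → τu ≡ τv
mainTheorem5 n E D ε _ cost-nonneg u v τu τv u-deact v-deact (t , _ , (k , phase , uv) , t≤τu , t≤τv) =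
  deactivationTime-unique {activeAt v} τu τv
    (IsDeactivationTimeOf-resp {activeAt u} {activeAt v} {τu}
      (activeAt-partner cost-nonneg {t} {k} {v} {u} {τv} v-deact t≤τv phase (connected-sym (run k) uv))
      (activeAt-partner cost-nonneg {t} {k} {u} {v} {τu} u-deact t≤τu phase uv)
      u-deact)
    v-deact
  where
  open MoatGrowing n E D ε
  open MoatGrowingProperties n E D ε

  activeAt : Fin n → ℚ → Set
  activeAt x s = ActiveAt s x
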